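{- Let $k>0$ be real and $Q_{k,n}=F_{k,n}+i\,F_{k,n+1}+j\,F_{k,n+2}+ij\,F_{k,n+3}$. For every integer $n\ge1$, $$Q_{k,n-1}Q_{k,n+1}-(Q_{k,n})^2=(-1)^n\big[\,2(k^2+2)\,j+(k^3+2k)\,ij\,\big].$$
   Context: For a real number $k>0$, the $k$-Fibonacci numbers are $F_{k,0}=0$, $F_{k,1}=1$, $F_{k,n+1}=kF_{k,n}+F_{k,n-1}$. Bicomplex numbers form the real commutative associative algebra with basis $\{1,i,j,ij\}$, $i^2=j^2=-1$, $ij=ji$, $(ij)^2=1$; $Q_{k,n}$ is the bicomplex $k$-Fibonacci quaternion, multiplied in this algebra. -}

module Defs where

open import Level using (_⊔_)
open import Data.Nat using (ℕ; zero; suc)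
open import Data.Product using (_×_)
open import Algebra.Bundles using (CommutativeRing)

-- Everything is parametrised by a commutative ring R (the paper uses R = ℝ)
-- and the parameter k ∈ R.
module _ {c ℓ} (R : CommutativeRing c ℓ) where
  open CommutativeRing R

  record Bicomplex : Set c where
    constructor bc
    field
      re  : Carrier
      ci  : Carrier
      cj  : Carrier
      cij : Carrier
  open Bicomplex public

  _≋_ : Bicomplex → Bicomplex → Set ℓ
  x ≋ y = (re x ≈ re y) × (ci x ≈ ci y) × (cj x ≈ cj y) × (cij x ≈ cij y)

  _⊕_ : Bicomplex → Bicomplex → Bicomplex
  x ⊕ y = bc (re x + re y) (ci x + ci y) (cj x + cj y) (cij x + cij y)

  _⊖_ : Bicomplex → Bicomplex → Bicomplex
  x ⊖ y = bc (re x - re y) (ci x - ci y) (cj x - cj y) (cij x - cij y)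

  -- multiplication: i² = j² = -1, ij = ji, (ij)² = 1, hence i·ij = -j, j·ij = -i
  _⊗_ : Bicomplex → Bicomplex → Bicomplex
  bc a b c' d ⊗ bc a' b' c'' d' =
    bc (a * a' - b * b' - c' * c'' + d * d')
       (a * b' + b * a' - c' * d' - d * c'')
       (a * c'' + c' * a' - b * d' - d * b')
       (a * d' + d * a' + b * c'' + c' * b')

  sgn : ℕ → Carrier
  sgn zero    = 1#
  sgn (suc n) = - 1# * sgn n

  _·_ : Carrier → Bicomplex → Bicomplex
  s · x = bc (s * re x) (s * ci x) (s * cj x) (s * cij x)

  kFib : Carrier → ℕ → Carrier
  kFib k zero            = 0#
  kFib k (suc zero)      = 1#
  kFib k (suc (suc n))   = k * kFib k (suc n) + kFib k n

  Q : Carrier → ℕ → Bicomplex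
  Q k n = bc (kFib k n) (kFib k (suc n)) (kFib k (suc (suc n))) (kFib k (suc (suc (suc n))))

  two : Carrier
  two = 1# + 1#

  rhsVec : Carrier → Bicomplex
  rhsVec k = bc 0# 0# (two * (k * k + two)) (k * k * k + two * k)

{-# OPTIONS --safe #-}

-- Put a = F_{k,m} and b = F_{k,m+1}.  Every component of Q_{k,m}, Q_{k,m+1}
-- and Q_{k,m+2} is a polynomial in k, a and b, and as a polynomial identity
--   Q_{k,m} Q_{k,m+2} - Q_{k,m+1}² = (a² + kab - b²) (2(k²+2) j + (k³+2k) ij).
-- The scalar factor a² + kab - b² changes sign under (a, b) ↦ (b, kb + a),
-- so along the k-Fibonacci sequence it equals (-1)^{m+1} (Cassini's identity).

module Submission where

open import Defs

open import Data.Nat as ℕ using (ℕ; zero; suc; _≤_; _∸_)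
open import Data.Nat.Properties using (+-suc)
open import Data.Integer as ℤ using (ℤ; +_; -[1+_])
open import Data.Integer.Properties using ([1+m]⊖[1+n]≡m⊖n; +◃n≡+n; neg-distribˡ-*; neg-distribʳ-*)
open import Data.Maybe using (Maybe; just; nothing)
open import Data.Product using (_,_)
open import Relation.Nullary using (yes; no)
import Relation.Binary.PropositionalEquality as ≡
open import Algebra.Bundles using (CommutativeRing)
open import Algebra.Solver.Ring.AlmostCommutativeRing using (fromCommutativeRing; _-Raw-AlmostCommutative⟶_)

-- An abstract commutative ring has no decidable equality, so the ring solver
-- is run with integer coefficients, interpreted by the canonical map ℤ → R.
module IntegerCoefficients {c ℓ} (R : CommutativeRing c ℓ) where
  open CommutativeRing R
  open import Algebra.Properties.Semiring.Mult.TCOptimised semiring using (_×_; 1+×; ×-homo-+; ×1-homo-*)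
  open import Algebra.Properties.Group +-group using (//-rightDividesʳ; ⁻¹-involutive)
  open import Algebra.Properties.AbelianGroup +-abelianGroup using (⁻¹-∙-comm)
  open import Algebra.Properties.CommutativeSemigroup +-commutativeSemigroup using (x∙yz≈y∙xz)
  open import Algebra.Properties.Ring ring using (-0#≈0#; -‿distribˡ-*; -‿distribʳ-*)
  open import Relation.Binary.Reasoning.Setoid setoid

  fromℤ : ℤ → Carrier
  fromℤ (+ n)      = n × 1#
  fromℤ -[1+ n ]   = - (suc n × 1#)

  fromℤ-⊖-+ : ∀ m n → fromℤ (m ℤ.⊖ n) + n × 1# ≈ m × 1#
  fromℤ-⊖-+ m       zero    = +-identityʳ _
  fromℤ-⊖-+ zero    (suc n) = -‿inverseˡ _
  fromℤ-⊖-+ (suc m) (suc n) = begin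
    fromℤ (suc m ℤ.⊖ suc n) + suc n × 1#  ≡⟨ ≡.cong (λ i → fromℤ i + suc n × 1#) ([1+m]⊖[1+n]≡m⊖n m n) ⟩
    fromℤ (m ℤ.⊖ n) + suc n × 1#          ≈⟨ +-congˡ (1+× n 1#) ⟩
    fromℤ (m ℤ.⊖ n) + (1# + n × 1#)       ≈⟨ x∙yz≈y∙xz _ _ _ ⟩
    1# + (fromℤ (m ℤ.⊖ n) + n × 1#)       ≈⟨ +-congˡ (fromℤ-⊖-+ m n) ⟩
    1# + m × 1#                           ≈⟨ 1+× m 1# ⟨
    suc m × 1#                            ∎

  fromℤ-⊖ : ∀ m n → fromℤ (m ℤ.⊖ n) ≈ m × 1# - n × 1#
  fromℤ-⊖ m n = trans (sym (//-rightDividesʳ (n × 1#) (fromℤ (m ℤ.⊖ n)))) (+-congʳ (fromℤ-⊖-+ m n))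

  fromℤ-+ : ∀ i j → fromℤ (i ℤ.+ j) ≈ fromℤ i + fromℤ j
  fromℤ-+ (+ m)    (+ n)    = ×-homo-+ 1# m n
  fromℤ-+ (+ m)    -[1+ n ] = fromℤ-⊖ m (suc n)
  fromℤ-+ -[1+ m ] (+ n)    = trans (fromℤ-⊖ n (suc m)) (+-comm _ _)
  fromℤ-+ -[1+ m ] -[1+ n ] = begin
    - (suc (suc (m ℕ.+ n)) × 1#)     ≡⟨ ≡.cong (λ l → - (suc l × 1#)) (+-suc m n) ⟨
    - ((suc m ℕ.+ suc n) × 1#)       ≈⟨ -‿cong (×-homo-+ 1# (suc m) (suc n)) ⟩
    - (suc m × 1# + suc n × 1#)      ≈⟨ ⁻¹-∙-comm _ _ ⟨
    - (suc m × 1#) + - (suc n × 1#)  ∎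

  fromℤ-neg : ∀ i → fromℤ (ℤ.- i) ≈ - fromℤ i
  fromℤ-neg (+ zero)  = sym -0#≈0#
  fromℤ-neg (+ suc n) = refl
  fromℤ-neg -[1+ n ]  = sym (⁻¹-involutive _)

  fromℤ-*-+ : ∀ m n → fromℤ (+ m ℤ.* + n) ≈ m × 1# * n × 1#
  fromℤ-*-+ m n = trans (reflexive (≡.cong fromℤ (+◃n≡+n (m ℕ.* n)))) (×1-homo-* m n)

  fromℤ-* : ∀ i j → fromℤ (i ℤ.* j) ≈ fromℤ i * fromℤ j
  fromℤ-* (+ m)    (+ n)    = fromℤ-*-+ m n
  fromℤ-* (+ m)    -[1+ n ] = begin
    fromℤ (+ m ℤ.* ℤ.- + suc n)        ≡⟨ ≡.cong fromℤ (neg-distribʳ-* (+ m) (+ suc n)) ⟨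
    fromℤ (ℤ.- (+ m ℤ.* + suc n))      ≈⟨ fromℤ-neg (+ m ℤ.* + suc n) ⟩
    - fromℤ (+ m ℤ.* + suc n)          ≈⟨ -‿cong (fromℤ-*-+ m (suc n)) ⟩
    - (m × 1# * suc n × 1#)            ≈⟨ -‿distribʳ-* _ _ ⟩
    m × 1# * - (suc n × 1#)            ∎
  fromℤ-* -[1+ m ] (+ n)    = begin
    fromℤ (ℤ.- + suc m ℤ.* + n)        ≡⟨ ≡.cong fromℤ (neg-distribˡ-* (+ suc m) (+ n)) ⟨
    fromℤ (ℤ.- (+ suc m ℤ.* + n))      ≈⟨ fromℤ-neg (+ suc m ℤ.* + n) ⟩
    - fromℤ (+ suc m ℤ.* + n)          ≈⟨ -‿cong (fromℤ-*-+ (suc m) n) ⟩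
    - (suc m × 1# * n × 1#)            ≈⟨ -‿distribˡ-* _ _ ⟩
    - (suc m × 1#) * n × 1#            ∎
  fromℤ-* -[1+ m ] -[1+ n ] = begin
    fromℤ (+ suc m ℤ.* + suc n)        ≈⟨ fromℤ-*-+ (suc m) (suc n) ⟩
    suc m × 1# * suc n × 1#            ≈⟨ ⁻¹-involutive _ ⟨
    - - (suc m × 1# * suc n × 1#)      ≈⟨ -‿cong (-‿distribʳ-* _ _) ⟩
    - (suc m × 1# * - (suc n × 1#))    ≈⟨ -‿distribˡ-* _ _ ⟩
    - (suc m × 1#) * - (suc n × 1#)    ∎

  fromℤ-homomorphism : ℤ.+-*-rawRing -Raw-AlmostCommutative⟶ fromCommutativeRing R
  fromℤ-homomorphism = record
    { ⟦_⟧    = fromℤ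
    ; +-homo = fromℤ-+
    ; *-homo = fromℤ-*
    ; -‿homo = fromℤ-neg
    ; 0-homo = refl
    ; 1-homo = refl
    }

  fromℤ-≟ : ∀ i j → Maybe (fromℤ i ≈ fromℤ j)
  fromℤ-≟ i j with i ℤ.≟ j
  ... | yes ≡.refl = just refl
  ... | no _       = nothing

  open import Algebra.Solver.Ring ℤ.+-*-rawRing (fromCommutativeRing R) fromℤ-homomorphism fromℤ-≟ public

module _ {c ℓ} (R : CommutativeRing c ℓ) where
  open CommutativeRing R

  ≋-trans : ∀ {x y z} → _≋_ R x y → _≋_ R y z → _≋_ R x z
  ≋-trans (p₁ , p₂ , p₃ , p₄) (q₁ , q₂ , q₃ , q₄) = trans p₁ q₁ , trans p₂ q₂ , trans p₃ q₃ , trans p₄ q₄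

  ·-congʳ : ∀ {s t} x → s ≈ t → _≋_ R (_·_ R s x) (_·_ R t x)
  ·-congʳ x s≈t = *-congʳ s≈t , *-congʳ s≈t , *-congʳ s≈t , *-congʳ s≈t

module _ {c ℓ} (R : CommutativeRing c ℓ) (k : CommutativeRing.Carrier R) where
  open CommutativeRing R
  open IntegerCoefficients R
  open import Algebra.Properties.Ring ring using (-1*x≈-x)
  open import Relation.Binary.Reasoning.Setoid setoid

  cassiniForm : Carrier → Carrier → Carrier
  cassiniForm a b = a * a + k * a * b - b * b

  cassiniFormᴾ : ∀ {n} → Polynomial n → Polynomial n → Polynomial n → Polynomial n
  cassiniFormᴾ κ a b = a :* a :+ κ :* a :* b :- b :* b

  cassiniForm-step : ∀ a b → cassiniForm b (k * b + a) ≈ - cassiniForm a b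
  cassiniForm-step = solve 3 (λ κ a b → cassiniFormᴾ κ b (κ :* b :+ a) := :- cassiniFormᴾ κ a b) refl k

  kFib-cassini : ∀ m → cassiniForm (kFib R k m) (kFib R k (suc m)) ≈ sgn R (suc m)
  kFib-cassini zero    = solve 1 (λ κ → cassiniFormᴾ κ (con (+ 0)) (con (+ 1)) := :- con (+ 1) :* con (+ 1)) refl k
  kFib-cassini (suc m) = begin
    cassiniForm (kFib R k (suc m)) (kFib R k (suc (suc m)))  ≈⟨ cassiniForm-step _ _ ⟩
    - cassiniForm (kFib R k m) (kFib R k (suc m))            ≈⟨ -‿cong (kFib-cassini m) ⟩
    - sgn R (suc m)                                          ≈⟨ -1*x≈-x _ ⟨
    - 1# * sgn R (suc m)                                     ∎

  -- Solver-side copies of the operations of Defs; they must evaluate to the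
  -- very same terms, so they repeat the defining clauses verbatim.
  record Bicomplexᴾ (n : ℕ) : Set where
    constructor bcᴾ
    field
      reᴾ ciᴾ cjᴾ cijᴾ : Polynomial n
  open Bicomplexᴾ

  _⊗ᴾ_ : ∀ {n} → Bicomplexᴾ n → Bicomplexᴾ n → Bicomplexᴾ n
  bcᴾ a b c' d ⊗ᴾ bcᴾ a' b' c'' d' =
    bcᴾ (a :* a' :- b :* b' :- c' :* c'' :+ d :* d')
        (a :* b' :+ b :* a' :- c' :* d' :- d :* c'')
        (a :* c'' :+ c' :* a' :- b :* d' :- d :* b')
        (a :* d' :+ d :* a' :+ b :* c'' :+ c' :* b')

  _⊖ᴾ_ : ∀ {n} → Bicomplexᴾ n → Bicomplexᴾ n → Bicomplexᴾ n
  x ⊖ᴾ y = bcᴾ (reᴾ x :- reᴾ y) (ciᴾ x :- ciᴾ y) (cjᴾ x :- cjᴾ y) (cijᴾ x :- cijᴾ y)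

  _·ᴾ_ : ∀ {n} → Polynomial n → Bicomplexᴾ n → Bicomplexᴾ n
  s ·ᴾ x = bcᴾ (s :* reᴾ x) (s :* ciᴾ x) (s :* cjᴾ x) (s :* cijᴾ x)

  twoᴾ : ∀ {n} → Polynomial n
  twoᴾ = con (+ 1) :+ con (+ 1)

  rhsVecᴾ : ∀ {n} → Polynomial n → Bicomplexᴾ n
  rhsVecᴾ κ = bcᴾ (con (+ 0)) (con (+ 0)) (twoᴾ :* (κ :* κ :+ twoᴾ)) (κ :* κ :* κ :+ twoᴾ :* κ)

  kFibᴾ : ∀ {n} → Polynomial n → Polynomial n → Polynomial n → ℕ → Polynomial n
  kFibᴾ κ a b zero          = a
  kFibᴾ κ a b (suc zero)    = b
  kFibᴾ κ a b (suc (suc i)) = κ :* kFibᴾ κ a b (suc i) :+ kFibᴾ κ a b i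

  Qᴾ : ∀ {n} → Polynomial n → Polynomial n → Polynomial n → ℕ → Bicomplexᴾ n
  Qᴾ κ a b i = bcᴾ (kFibᴾ κ a b i) (kFibᴾ κ a b (suc i)) (kFibᴾ κ a b (suc (suc i))) (kFibᴾ κ a b (suc (suc (suc i))))

  defectᴾ scaledᴾ : Polynomial 3 → Polynomial 3 → Polynomial 3 → Bicomplexᴾ 3
  defectᴾ κ a b = (Qᴾ κ a b 0 ⊗ᴾ Qᴾ κ a b 2) ⊖ᴾ (Qᴾ κ a b 1 ⊗ᴾ Qᴾ κ a b 1)
  scaledᴾ κ a b = cassiniFormᴾ κ a b ·ᴾ rhsVecᴾ κ

  Q-cassini-defect : ∀ m →
    _≋_ R (_⊖_ R (_⊗_ R (Q R k m) (Q R k (suc (suc m)))) (_⊗_ R (Q R k (suc m)) (Q R k (suc m))))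
          (_·_ R (cassiniForm (kFib R k m) (kFib R k (suc m))) (rhsVec R k))
  Q-cassini-defect m =
      solve 3 (λ κ a b → reᴾ (defectᴾ κ a b) := reᴾ (scaledᴾ κ a b)) refl k a b
    , solve 3 (λ κ a b → ciᴾ (defectᴾ κ a b) := ciᴾ (scaledᴾ κ a b)) refl k a b
    , solve 3 (λ κ a b → cjᴾ (defectᴾ κ a b) := cjᴾ (scaledᴾ κ a b)) refl k a b
    , solve 3 (λ κ a b → cijᴾ (defectᴾ κ a b) := cijᴾ (scaledᴾ κ a b)) refl k a b
    where
    a b : Carrier
    a = kFib R k m
    b = kFib R k (suc m)

mainTheorem8 : ∀ {c ℓ} (R : CommutativeRing c ℓ) (k : CommutativeRing.Carrier R) (n : ℕ) → 1 ≤ n →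
    _≋_ R (_⊖_ R (_⊗_ R (Q R k (n ∸ 1)) (Q R k (suc n))) (_⊗_ R (Q R k n) (Q R k n)))
          (_·_ R (sgn R n) (rhsVec R k))
mainTheorem8 R k (suc m) _ =
  ≋-trans R (Q-cassini-defect R k m) (·-congʳ R (rhsVec R k) (kFib-cassini R k m))
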